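{- Let $\tau = \alpha\cdot\mathrm{issue}(p,t)\cdot\beta\cdot\mathrm{com}(p,t)$ be a minimal anomaly of a program $P$ such that $\mathrm{issue}(p,t)$ happens-before $\mathrm{com}(p,t)$ through $\beta$. Then there exists an event $\mathrm{issue}(p',t')$ in $\beta$ such that $(\mathrm{issue}(p',t'),\mathrm{com}(p,t))\in\mathrm{hb}$.
   Context: Programs consist of processes executing sequences of transactions (begin; reads of shared variables into registers, writes to shared variables, assume statements; commit). Under snapshot isolation (SI), a transaction reads from a snapshot of the central memory taken at its begin, its writes are local until commit, and its commit is allowed only if no transaction committed after its begin wrote a variable it writes. Under serializability transactions execute atomically. A trace of an SI execution is a sequence of events issue$(p,t)$ (begin, reads and local writes of transaction $t$ of process $p$) and com$(p,t)$ (its commit), with dependency relations po (program order), rf (write-read), st (commit order of writes to the same variable), cf (from a reader of $x$ to the commit of a write to $x$ st-after the write it read), sametr (issue$(p,t)$ to com$(p,t)$). $\mathrm{hb}^1=\mathrm{po}\cup\mathrm{st}\cup\mathrm{rf}\cup\mathrm{cf}\cup\mathrm{sametr}$, hb its transitive closure. An anomaly of $P$ is a trace of $P$ under SI that is not a trace of $P$ under serializability. For $\tau = \alpha\cdot a\cdot\beta\cdot b\cdot\gamma$, $a$ happens-before $b$ through $\beta$ if there is a nonempty subsequence $c_1\cdots c_n$ of $\beta$ with $(c_i,c_{i+1})\in\mathrm{hb}^1$ for $0\le i\le n$, $c_0=a$, $c_{n+1}=b$. A transaction $t$ is delayed in $\tau=\alpha\cdot\mathrm{issue}(p,t)\cdot\beta\cdot\mathrm{com}(p,t)\cdot\gamma$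 if $\mathrm{issue}(p,t)$ happens-before $\mathrm{com}(p,t)$ through $\beta$. An anomaly is minimal if it has the least number of delayed transactions among all anomalies of $P$. -}

module Defs where

open import Data.Nat using (ℕ; zero; suc; _<_; _≤_; _≡ᵇ_)
open import Data.Bool using (Bool; true; false; if_then_else_)
open import Data.List using (List; []; _∷_; map; length)
open import Data.Maybe using (Maybe; just; nothing)
open import Data.Product using (_×_; _,_; Σ; ∃; ∃-syntax; proj₁; proj₂)
open import Data.Sum using (_⊎_)
open import Data.Unit using (⊤)
open import Relation.Nullary using (¬_)
open import Relation.Binary.PropositionalEquality using (_≡_)
open import Relation.Binary.Construct.Closure.Transitive using (TransClosure)
open import Data.List.Membership.Propositional using (_∈_; _∉_)
open import Data.List.Relation.Unary.Unique.Propositional using (Unique)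
open import Function.Bundles using (_⇔_)

Var Val Reg : Set
Var = ℕ
Val = ℕ
Reg = ℕ

RegState : Set
RegState = Reg → Val

Mem : Set
Mem = Var → Val

-- Instructions of a transaction body (expressions shallowly embedded
-- as functions of the process-local register state).
data Instr : Set where
  read   : Reg → Var → Instr
  write  : Var → (RegState → Val) → Instr
  assume : (RegState → Bool) → Instr

Transaction : Set
Transaction = List Instr

Process : Set
Process = List Transaction

Program : Set
Program = List Process

nth : {A : Set} → List A → ℕ → Maybe A
nth []       _       = nothing
nth (a ∷ as) zero    = just a
nth (a ∷ as) (suc n) = nth as n

upd : {A : Set} → (ℕ → A) → ℕ → A → ℕ → A
upd f n a m = if m ≡ᵇ n then a else f m

-- local write buffer, most recent write first
lookupW : List (Var × Val) → Var → Maybe Val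
lookupW []             x = nothing
lookupW ((y , v) ∷ ws) x = if x ≡ᵇ y then just v else lookupW ws x

record Local : Set where
  constructor mkLocal
  field
    regs      : RegState
    writes    : List (Var × Val)
    readsSnap : List Var
open Local public

-- run a body against the snapshot; nothing = blocked by an assume
runT : Mem → Local → Transaction → Maybe Local
runT m l [] = just l
runT m (mkLocal ρ ws rs) (read r x ∷ is) with lookupW ws x
... | just v  = runT m (mkLocal (upd ρ r v) ws rs) is
... | nothing = runT m (mkLocal (upd ρ r (m x)) ws (x ∷ rs)) is
runT m (mkLocal ρ ws rs) (write x e ∷ is) = runT m (mkLocal ρ ((x , e ρ) ∷ ws) rs) is
runT m (mkLocal ρ ws rs) (assume b ∷ is) =
  if b ρ then runT m (mkLocal ρ ws rs) is else nothing

record Pending : Set where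
  constructor mkPending
  field
    loc      : Local
    conflict : List Var   -- variables written by commits since the issue
open Pending public

record Config : Set where
  constructor mkConfig
  field
    mem  : Mem
    preg : ℕ → RegState
    next : ℕ → ℕ                 -- index of the next transaction to issue
    pend : ℕ → Maybe Pending
open Config public

initConfig : Config
initConfig = mkConfig (λ _ → 0) (λ _ _ → 0) (λ _ → 0) (λ _ → nothing)

-- events of a trace: issue(p,t) annotated with the variables it reads
-- from its snapshot, com(p,t) annotated with the variables it writes.
-- t is the index of the transaction within process p.
data AEvent : Set where
  iss : (p t : ℕ) → (rd : List Var) → AEvent
  cmt : (p t : ℕ) → (wr : List Var) → AEvent

data Event : Set where
  issue : ℕ → ℕ → Event
  com   : ℕ → ℕ → Event

evOf : AEvent → Event
evOf (iss p t _) = issue p t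
evOf (cmt p t _) = com p t

applyW : List (Var × Val) → Mem → Mem
applyW ws m x with lookupW ws x
... | just v  = v
... | nothing = m x

addConflict : List Var → Pending → Pending
addConflict xs (mkPending l c) = mkPending l (xs Data.List.++ c)

mapMaybe : {A B : Set} → (A → B) → Maybe A → Maybe B
mapMaybe f nothing  = nothing
mapMaybe f (just a) = just (f a)

data Step (P : Program) : Config → AEvent → Config → Set where
  stepIssue : ∀ {c p t proc T l} →
    nth P p ≡ just proc → nth proc t ≡ just T →
    next c p ≡ t → pend c p ≡ nothing →
    runT (mem c) (mkLocal (preg c p) [] []) T ≡ just l →
    Step P c (iss p t (readsSnap l))
      (mkConfig (mem c) (preg c) (upd (next c) p (suc t))
                (upd (pend c) p (just (mkPending l []))))
  stepCom : ∀ {c p t pd} →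
    pend c p ≡ just pd → next c p ≡ suc t →
    (∀ x → x ∈ map proj₁ (writes (loc pd)) → x ∉ conflict pd) →
    Step P c (cmt p t (map proj₁ (writes (loc pd))))
      (mkConfig (applyW (writes (loc pd)) (mem c))
                (upd (preg c) p (regs (loc pd)))
                (next c)
                (λ q → if q ≡ᵇ p then nothing
                       else mapMaybe (addConflict (map proj₁ (writes (loc pd)))) (pend c q)))

data Run (P : Program) : Config → List AEvent → Config → Set where
  done : ∀ {c} → Run P c [] c
  step : ∀ {c a c' as c''} → Step P c a c' → Run P c' as c'' → Run P c (a ∷ as) c''

-- traces of P under SI (every issued transaction has committed)
SITrace : Program → List AEvent → Set
SITrace P τ = Σ Config λ c → Run P initConfig τ c × (∀ q → pend c q ≡ nothing)

data Serial : List AEvent → Set where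
  nil  : Serial []
  pair : ∀ {p t r w rest} → Serial rest → Serial (iss p t r ∷ cmt p t w ∷ rest)

SERTrace : Program → List AEvent → Set
SERTrace P τ = SITrace P τ × Serial τ

IssueAt : List AEvent → ℕ → ℕ → ℕ → Set
IssueAt τ i p t = ∃[ r ] nth τ i ≡ just (iss p t r)

ComAt : List AEvent → ℕ → ℕ → ℕ → Set
ComAt τ j p t = ∃[ w ] nth τ j ≡ just (cmt p t w)

Reads : List AEvent → ℕ → Var → Set
Reads τ i x = ∃[ p ] ∃[ t ] ∃[ r ] (nth τ i ≡ just (iss p t r) × x ∈ r)

Writes : List AEvent → ℕ → Var → Set
Writes τ k x = ∃[ p ] ∃[ t ] ∃[ w ] (nth τ k ≡ just (cmt p t w) × x ∈ w)

-- the write (commit position, or nothing = initial value) that a read of x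
-- at position i reads from: the last commit writing x before i
LastWriter : List AEvent → Var → ℕ → Maybe ℕ → Set
LastWriter τ x i (just k) = k < i × Writes τ k x × (∀ k' → k < k' → k' < i → ¬ Writes τ k' x)
LastWriter τ x i nothing  = ∀ k → k < i → ¬ Writes τ k x

-- a commit position j is st-after the write w (initial write is st-first)
StAfter : Maybe ℕ → ℕ → Set
StAfter nothing  j = ⊤
StAfter (just k) j = k < j

PO : List AEvent → ℕ → ℕ → Set
PO τ i j = i < j × ∃[ p ] ∃[ t ] ∃[ t' ] (IssueAt τ i p t × IssueAt τ j p t')

ST : List AEvent → ℕ → ℕ → Set
ST τ i j = i < j × ∃[ x ] (Writes τ i x × Writes τ j x)

RF : List AEvent → ℕ → ℕ → Set
RF τ k i = ∃[ x ] (Reads τ i x × LastWriter τ x i (just k))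

CF : List AEvent → ℕ → ℕ → Set
CF τ i j = ∃[ x ] (Reads τ i x × Writes τ j x × ∃[ w ] (LastWriter τ x i w × StAfter w j))

SameTr : List AEvent → ℕ → ℕ → Set
SameTr τ i j = ∃[ p ] ∃[ t ] (IssueAt τ i p t × ComAt τ j p t)

HB1 : List AEvent → ℕ → ℕ → Set
HB1 τ i j = PO τ i j ⊎ ST τ i j ⊎ RF τ i j ⊎ CF τ i j ⊎ SameTr τ i j

HB : List AEvent → ℕ → ℕ → Set
HB τ = TransClosure (HB1 τ)

evAt : List AEvent → ℕ → Maybe Event
evAt τ i = mapMaybe evOf (nth τ i)

RelEv : (List AEvent → ℕ → ℕ → Set) → List AEvent → Event → Event → Set
RelEv R τ e e' = ∃[ i ] ∃[ j ] (evAt τ i ≡ just e × evAt τ j ≡ just e' × R τ i j)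

SameTrace : List AEvent → List AEvent → Set
SameTrace τ σ =
  (∀ e → (e ∈ map evOf τ) ⇔ (e ∈ map evOf σ)) ×
  (∀ e e' → RelEv PO τ e e' ⇔ RelEv PO σ e e') ×
  (∀ e e' → RelEv RF τ e e' ⇔ RelEv RF σ e e') ×
  (∀ e e' → RelEv ST τ e e' ⇔ RelEv ST σ e e') ×
  (∀ e e' → RelEv CF τ e e' ⇔ RelEv CF σ e e')

Anomaly : Program → List AEvent → Set
Anomaly P τ = SITrace P τ × ¬ (∃[ σ ] (SERTrace P σ × SameTrace τ σ))

-- PathTo τ b c : a chain c = c₁ < c₂ < … < cₙ < b with hb¹ links ending in b
data PathTo (τ : List AEvent) (b : ℕ) : ℕ → Set where
  last : ∀ {c} → HB1 τ c b → PathTo τ b c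
  link : ∀ {c d} → c < d → d < b → HB1 τ c d → PathTo τ b d → PathTo τ b c

HBThrough : List AEvent → ℕ → ℕ → Set
HBThrough τ a b = ∃[ c ] (a < c × c < b × HB1 τ a c × PathTo τ b c)

Delayed : List AEvent → ℕ → ℕ → Set
Delayed τ p t = ∃[ i ] ∃[ j ] (IssueAt τ i p t × ComAt τ j p t × HBThrough τ i j)

NumDelayed : List AEvent → ℕ → Set
NumDelayed τ n = ∃[ ds ] (Unique ds × (∀ p t → ((p , t) ∈ ds) ⇔ Delayed τ p t) × length ds ≡ n)

MinimalAnomaly : Program → List AEvent → Set
MinimalAnomaly P τ =
  Anomaly P τ ×
  ∃[ n ] (NumDelayed τ n × (∀ σ m → Anomaly P σ → NumDelayed σ m → n ≤ m))

{-# OPTIONS --safe #-}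
-- Follow the hb¹-chain through β to its last event d before com(p,t). An
-- hb¹ edge into a commit starts at an issue unless it is an st edge, and an
-- st edge would mean that a transaction committed after issue(p,t) wrote a
-- variable that t writes too, which the SI commit rule forbids. So d is an
-- issue, and (d, com(p,t)) ∈ hb¹.
module Submission where

open import Defs
open import Data.Nat using (ℕ; zero; suc; _<_; _≤_; _≡ᵇ_; s≤s)
open import Data.Nat.Properties using (_≟_; <-irrefl; <-≤-trans; ≤-refl; ≤-trans; <⇒≤; ≤-reflexive; m<n⇒m<1+n)
open import Data.Bool using (true; false)
open import Data.Maybe using (just; nothing)
open import Data.Empty using (⊥-elim)
open import Data.Sum using (inj₁; inj₂; _⊎_)
open import Data.List using (List; length)
open import Data.Product using (_×_; ∃-syntax; _,_)
open import Function using (_∘_)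
open import Relation.Nullary using (¬_; yes; no)
open import Relation.Binary.PropositionalEquality using (_≡_; _≢_; refl; sym; trans; cong)
open import Relation.Binary.Construct.Closure.Transitive using ([_])
open import Data.List.Membership.Propositional using (_∈_; _∉_)
open import Data.List.Membership.Propositional.Properties using (∈-++⁺ˡ; ∈-++⁺ʳ)

≡ᵇ-refl : ∀ n → (n ≡ᵇ n) ≡ true
≡ᵇ-refl zero    = refl
≡ᵇ-refl (suc n) = ≡ᵇ-refl n

≢⇒≡ᵇ-false : ∀ {m n} → m ≢ n → (m ≡ᵇ n) ≡ false
≢⇒≡ᵇ-false {zero}  {zero}  m≢n = ⊥-elim (m≢n refl)
≢⇒≡ᵇ-false {zero}  {suc n} _   = refl
≢⇒≡ᵇ-false {suc m} {zero}  _   = refl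
≢⇒≡ᵇ-false {suc m} {suc n} m≢n = ≢⇒≡ᵇ-false (m≢n ∘ cong suc)

Open : Config → ℕ → ℕ → Set
Open c p t = ∃[ pd ] (pend c p ≡ just pd × next c p ≡ suc t)

Conflicted : Config → ℕ → ℕ → Var → Set
Conflicted c p t x = ∃[ pd ] (pend c p ≡ just pd × next c p ≡ suc t × x ∈ conflict pd)

Retired : Config → ℕ → ℕ → Set
Retired c p t = t < next c p × (pend c p ≡ nothing ⊎ suc t < next c p)

-- From a Doomed configuration on, transaction t of p can never commit a write to x.
Doomed : Config → ℕ → ℕ → Var → Set
Doomed c p t x = Conflicted c p t x ⊎ Retired c p t

module _ {P : Program} where

  issue-opens : ∀ {c c' p t r} → Step P c (iss p t r) c' → Open c' p t
  issue-opens (stepIssue {p = p} _ _ _ _ _) rewrite ≡ᵇ-refl p = _ , refl , refl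

  retired-step : ∀ {c a c' p t} → Retired c p t → Step P c a c' → Retired c' p t
  retired-step {p = p} (t<n , over) (stepIssue {p = q} _ _ refl _ _) with p ≟ q
  ... | yes refl rewrite ≡ᵇ-refl p = m<n⇒m<1+n t<n , inj₂ (s≤s t<n)
  ... | no p≢q   rewrite ≢⇒≡ᵇ-false p≢q = t<n , over
  retired-step {p = p} (t<n , over) (stepCom {p = q} _ _ _) with p ≟ q
  ... | yes refl rewrite ≡ᵇ-refl p = t<n , inj₁ refl
  ... | no p≢q   rewrite ≢⇒≡ᵇ-false p≢q with over
  ...   | inj₁ pp≡nothing rewrite pp≡nothing = t<n , inj₁ refl
  ...   | inj₂ 1+t<n = t<n , inj₂ 1+t<n

  retired-cannot-commit : ∀ {c c' p t w} → Retired c p t → ¬ Step P c (cmt p t w) c'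
  retired-cannot-commit (_ , inj₁ pp≡nothing) (stepCom pp≡just _ _) with trans (sym pp≡just) pp≡nothing
  ... | ()
  retired-cannot-commit (_ , inj₂ 1+t<n) (stepCom _ n≡1+t _) = <-irrefl (sym n≡1+t) 1+t<n

  open-cannot-issue : ∀ {c c' p t t' r} → Open c p t → ¬ Step P c (iss p t' r) c'
  open-cannot-issue (_ , pp≡just , _) (stepIssue _ _ _ pp≡nothing _) with trans (sym pp≡just) pp≡nothing
  ... | ()

  own-commit-retires : ∀ {c c' p t t' w} → Open c p t → Step P c (cmt p t' w) c' → Retired c' p t
  own-commit-retires {p = p} (_ , _ , n≡1+t) (stepCom _ _ _) rewrite ≡ᵇ-refl p =
    ≤-reflexive (sym n≡1+t) , inj₁ refl

  open-step : ∀ {c a c' p t} → Open c p t → Step P c a c' → Open c' p t ⊎ Retired c' p t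
  open-step {p = p} o s@(stepIssue {p = q} _ _ _ _ _) with p ≟ q
  ... | yes refl = ⊥-elim (open-cannot-issue o s)
  ... | no p≢q rewrite ≢⇒≡ᵇ-false p≢q = inj₁ o
  open-step {p = p} o@(_ , pp≡just , n≡1+t) s@(stepCom {p = q} _ _ _) with p ≟ q
  ... | yes refl = inj₂ (own-commit-retires o s)
  ... | no p≢q rewrite ≢⇒≡ᵇ-false p≢q | pp≡just = inj₁ (_ , refl , n≡1+t)

  conflicted-step : ∀ {c a c' p t x} → Conflicted c p t x → Step P c a c' → Doomed c' p t x
  conflicted-step {p = p} (pd , pp≡just , n≡1+t , x∈) s@(stepIssue {p = q} _ _ _ _ _) with p ≟ q
  ... | yes refl = ⊥-elim (open-cannot-issue (pd , pp≡just , n≡1+t) s)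
  ... | no p≢q rewrite ≢⇒≡ᵇ-false p≢q = inj₁ (pd , pp≡just , n≡1+t , x∈)
  conflicted-step {p = p} (pd , pp≡just , n≡1+t , x∈) s@(stepCom {p = q} _ _ _) with p ≟ q
  ... | yes refl = inj₂ (own-commit-retires (pd , pp≡just , n≡1+t) s)
  ... | no p≢q rewrite ≢⇒≡ᵇ-false p≢q | pp≡just = inj₁ (_ , refl , n≡1+t , ∈-++⁺ʳ _ x∈)

  open-commit-step : ∀ {c c' p t q t' w x} → Open c p t → Step P c (cmt q t' w) c' → x ∈ w →
                     Doomed c' p t x
  open-commit-step {p = p} o@(_ , pp≡just , n≡1+t) s@(stepCom {p = q} _ _ _) x∈w with p ≟ q
  ... | yes refl = inj₂ (own-commit-retires o s)
  ... | no p≢q rewrite ≢⇒≡ᵇ-false p≢q | pp≡just = inj₁ (_ , refl , n≡1+t , ∈-++⁺ˡ x∈w)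

  doomed-step : ∀ {c a c' p t x} → Doomed c p t x → Step P c a c' → Doomed c' p t x
  doomed-step (inj₁ conflicted) s = conflicted-step conflicted s
  doomed-step (inj₂ retired)    s = inj₂ (retired-step retired s)

  doomed-commit : ∀ {c c' p t w x} → Doomed c p t x → Step P c (cmt p t w) c' → x ∉ w
  doomed-commit (inj₁ (pd , pp≡just , _ , x∈)) (stepCom pp≡just′ _ no-conflict) x∈w
    with trans (sym pp≡just) pp≡just′
  ... | refl = no-conflict _ x∈w x∈
  doomed-commit (inj₂ retired) s = ⊥-elim (retired-cannot-commit retired s)

  doomed-run : ∀ {c as c'' p t x j w} → Doomed c p t x → Run P c as c'' →
               nth as j ≡ just (cmt p t w) → x ∉ w
  doomed-run {j = zero}  d (step s _) refl = doomed-commit d s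
  doomed-run {j = suc j} d (step s r) eq   = doomed-run (doomed-step d s) r eq

  open-run : ∀ {c as c'' p t q t' w w' x m j} → Open c p t → Run P c as c'' →
             nth as m ≡ just (cmt q t' w) → x ∈ w → m < j → nth as j ≡ just (cmt p t w') → x ∉ w'
  open-run {m = zero}  {suc j} o (step s r) refl x∈w _ eq = doomed-run (open-commit-step o s x∈w) r eq
  open-run {m = suc m} {suc j} o (step s r) eqm x∈w (s≤s m<j) eq with open-step o s
  ... | inj₁ o′      = open-run o′ r eqm x∈w m<j eq
  ... | inj₂ retired = doomed-run (inj₂ retired) r eq

  first-committer-wins : ∀ {c τ c'' p t r q t' w w' x i m j} → Run P c τ c'' →
    nth τ i ≡ just (iss p t r) → i < m → nth τ m ≡ just (cmt q t' w) → x ∈ w →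
    m < j → nth τ j ≡ just (cmt p t w') → x ∉ w'
  first-committer-wins {i = zero} {suc m} {suc j} (step s r) refl _ eqm x∈w (s≤s m<j) eq =
    open-run (issue-opens s) r eqm x∈w m<j eq
  first-committer-wins {i = suc i} {suc m} {suc j} (step _ r) eqi (s≤s i<m) eqm x∈w (s≤s m<j) eq =
    first-committer-wins r eqi i<m eqm x∈w m<j eq

  no-ST-into-own-commit : ∀ {c τ c'' p t i m j} → Run P c τ c'' →
    IssueAt τ i p t → ComAt τ j p t → i < m → ¬ ST τ m j
  no-ST-into-own-commit run (_ , eqi) (_ , eqj) i<m
                        (m<j , _ , (_ , _ , _ , eqm , x∈w) , (_ , _ , _ , eqj′ , x∈w′))
    with trans (sym eqj) eqj′
  ... | refl = first-committer-wins run eqi i<m eqm x∈w m<j eqj x∈w′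

last-edge : ∀ {τ b c} → c < b → PathTo τ b c → ∃[ d ] (c ≤ d × d < b × HB1 τ d b)
last-edge c<b (last e) = _ , ≤-refl , c<b , e
last-edge _ (link c<d d<b _ path) with last-edge d<b path
... | e , d≤e , e<b , edge = e , ≤-trans (<⇒≤ c<d) d≤e , e<b , edge

HB1-into-commit : ∀ {τ d j p t} → ComAt τ j p t → HB1 τ d j →
                  (∃[ p' ] ∃[ t' ] IssueAt τ d p' t') ⊎ ST τ d j
HB1-into-commit _ (inj₁ (_ , _ , _ , _ , issue-d , _))            = inj₁ (_ , _ , issue-d)
HB1-into-commit _ (inj₂ (inj₁ st))                                = inj₂ st
HB1-into-commit (_ , eqj) (inj₂ (inj₂ (inj₁ (_ , (_ , _ , _ , eqj′ , _) , _))))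
  with trans (sym eqj) eqj′
... | ()
HB1-into-commit _ (inj₂ (inj₂ (inj₂ (inj₁ (_ , (_ , _ , r , eqd , _) , _))))) = inj₁ (_ , _ , r , eqd)
HB1-into-commit _ (inj₂ (inj₂ (inj₂ (inj₂ (_ , _ , issue-d , _)))))          = inj₁ (_ , _ , issue-d)

lemma4 : (P : Program) (τ : List AEvent) (p t i j : ℕ) →
    MinimalAnomaly P τ → suc j ≡ length τ →
    IssueAt τ i p t → ComAt τ j p t → HBThrough τ i j →
    ∃[ k ] (i < k × k < j × (∃[ p' ] ∃[ t' ] IssueAt τ k p' t') × HB τ k j)
lemma4 P τ p t i j (((_ , run , _) , _) , _) _ issue-i com-j (c , i<c , c<j , _ , path)
  with last-edge c<j path
... | d , c≤d , d<j , e with HB1-into-commit com-j e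
...   | inj₁ issue-d = d , <-≤-trans i<c c≤d , d<j , issue-d , [ e ]
...   | inj₂ st      = ⊥-elim (no-ST-into-own-commit run issue-i com-j (<-≤-trans i<c c≤d) st)
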